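{- Let $(\mathbf A,\mathbf A')$ be a promise template and $k\ge1$. Then $\mathrm{PCSP}(\mathbf A,\mathbf A')$ has width $k$ if and only if it reduces to $\mathrm{CSP}(\bot)$ by the $k$-consistency reduction, i.e., $\kappa_k^{\mathbf A,\bot}$ is a reduction from $\mathrm{PCSP}(\mathbf A,\mathbf A')$ to $\mathrm{CSP}(\bot)$.
   Context: Signatures and structures: a (multisorted relational) signature consists of types and relational symbols, each $R$ with arity $\mathrm{ar}_R$ a tuple of types (possibly empty, i.e. nullary). A structure has a set $A_t$ per type and relations $R^{\mathbf A}\subseteq A_{\mathrm{ar}_R(1)}\times\dots\times A_{\mathrm{ar}_R(k)}$. Homomorphisms are type-wise maps preserving relations. The power $\mathbf B^D$ has domains $B_t^D$ and $(b_1,\dots,b_k)\in R^{\mathbf B^D}$ iff $(b_1(i),\dots,b_k(i))\in R^{\mathbf B}$ for all $i\in D$. Promise CSP: a promise template is a pair $(\mathbf A,\mathbf A')$ of structures of the same signature with $\mathbf A$ finite and $\mathbf A\to\mathbf A'$; $\mathrm{PCSP}(\mathbf A,\mathbf A')$: given finite $\mathbf X$, answer yes if $\mathbf X\to\mathbf A$ and no if $\mathbf X\not\to\mathbf A'$; $\mathrm{CSP}(\mathbf B)=\mathrm{PCSP}(\mathbf B,\mathbf B)$. A map $\psi$ is a reduction from $\mathrm{PCSP}(\mathbf A,\mathbf A')$ to $\mathrm{PCSP}(\mathbf B,\mathbf B')$ if for all finite $\mathbf X$: $\mathbf X\to\mathbf A\Rightarrow\psi(\mathbf X)\to\mathbf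 B$, and $\psi(\mathbf X)\to\mathbf B'\Rightarrow\mathbf X\to\mathbf A'$. Trivial CSP: let $\Omega$ be the signature with no types and one nullary symbol $C$; $\bot$ is the $\Omega$-structure with $C$ empty and $\top$ the one with $C$ nonempty. $\mathrm{CSP}(\bot)$ is the trivial CSP. $k$-consistency: for a $\Pi$-structure $\mathbf X$ and a set $K$ of its elements, a partial homomorphism $K\to\mathbf A$ is a type-preserving $f\colon K\to A$ with $(f(v_1),\dots,f(v_m))\in R^{\mathbf A}$ for all $(v_1,\dots,v_m)\in R^{\mathbf X}$ with all $v_i\in K$. Steps: (1) for each set $K$ of at most $k$ elements let $\mathcal F_K$ be all partial homomorphisms $K\to\mathbf A$; (2) for $L\subset K$ remove from $\mathcal F_L$ maps not extending to a member of $\mathcal F_K$ and from $\mathcal F_K$ maps $g$ with $g|_L\notin\mathcal F_L$; (3) repeat (2) until stable. The $k$-consistency test accepts $\mathbf X$ iff all $\mathcal F_K$ are nonempty. $\mathrm{PCSP}(\mathbf A,\mathbf A')$ has width $k$ if the $k$-consistency test solves it: it accepts every finite $\mathbf X$ with $\mathbf X\to\mathbf A$ and rejects every finite $\mathbf X$ with $\mathbf X\not\to\mathbf A'$. The $k$-consistency reduction $\kappa_k^{\mathbf A,\mathbf B}(\mathbf X)$ continues: (4) take a copy of $\mathbf B^{\mathcal F_K}$ (elements $(K;b)$) for each $K$; (5) identify $(K;b\circ\rho)$ with $(L;b)$ for $L\subseteq K$, $b\colon\mathcal F_L\to B_t$, $\rho\colon\mathcal F_K\to\mathcal F_L$ restriction,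 and take the quotient (relations are the images). -}

module Defs where

open import Data.Nat using (ℕ; _≤_)
open import Data.Fin using (Fin)
open import Data.Fin.Subset using (Subset; _⊆_; ∣_∣; _∈_)
open import Data.List using (List; []; allFin)
open import Data.Nat.ListAction using (sum)
import Data.List as List
open import Data.List.Relation.Unary.All using (All; []; _∷_)
import Data.List.Relation.Unary.All as All
open import Data.Product using (Σ; _×_; _,_; proj₁)
open import Data.Empty using (⊥)
open import Data.Unit using (⊤; tt)
open import Relation.Binary.PropositionalEquality using (_≡_; refl; cong; sym; subst)
open import Relation.Nullary using (Dec; ¬_)

record Signature : Set where
  field
    nTy  : ℕ
    nSym : ℕ
    ar   : Fin nSym → List (Fin nTy)

record Structure (Π : Signature) : Set₁ where
  open Signature Π
  field
    Dom : Fin nTy → Set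
    Rel : (R : Fin nSym) → All Dom (ar R) → Set

record Hom {Π : Signature} (A B : Structure Π) : Set where
  open Signature Π
  open Structure
  field
    fun  : (t : Fin nTy) → Dom A t → Dom B t
    pres : (R : Fin nSym) (xs : All (Dom A) (ar R)) →
           Rel A R xs → Rel B R (All.map (λ {t} x → fun t x) xs)

record FinStructure (Π : Signature) : Set₁ where
  open Signature Π
  field
    size : Fin nTy → ℕ
    Rel  : (R : Fin nSym) → All (λ t → Fin (size t)) (ar R) → Set
    rel? : (R : Fin nSym) (xs : All (λ t → Fin (size t)) (ar R)) → Dec (Rel R xs)

  str : Structure Π
  str = record { Dom = λ t → Fin (size t) ; Rel = Rel }

Pow : {Δ : Signature} → Structure Δ → Set → Structure Δ
Pow B D = record
  { Dom = λ t → D → Structure.Dom B t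
  ; Rel = λ R bs → (i : D) → Structure.Rel B R (All.map (λ b → b i) bs) }

-- Quotient structures, given by a presentation: a structure together with
-- a relation on each domain generating the identification.  The quotient
-- has as relations the images of the relations.  A homomorphism out of the
-- quotient is (by the universal property) exactly a homomorphism out of
-- the base structure that is constant on identified pairs.

record QStructure (Δ : Signature) : Set₁ where
  open Signature Δ
  field
    base  : Structure Δ
    ident : (t : Fin nTy) → Structure.Dom base t → Structure.Dom base t → Set

record QHom {Δ : Signature} (Q : QStructure Δ) (B : Structure Δ) : Set where
  open Signature Δ
  open QStructure Q
  field
    hom  : Hom base B
    resp : (t : Fin nTy) (x y : Structure.Dom base t) →
           ident t x y → Hom.fun hom t x ≡ Hom.fun hom t y

Ω : Signature
Ω = record { nTy = 0 ; nSym = 1 ; ar = λ _ → [] }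

⊥S : Structure Ω
⊥S = record { Dom = λ () ; Rel = λ _ _ → ⊥ }

⊤S : Structure Ω
⊤S = record { Dom = λ () ; Rel = λ _ _ → ⊤ }

IsReduction : {Π Δ : Signature} → (FinStructure Π → QStructure Δ) →
              Structure Π → Structure Π → Structure Δ → Structure Δ → Set₁
IsReduction {Π} ψ A A' B B' =
  (X : FinStructure Π) →
    (Hom (FinStructure.str X) A → QHom (ψ X) B) ×
    (QHom (ψ X) B' → Hom (FinStructure.str X) A')

module Consistency {Π : Signature} (A X : FinStructure Π) (k : ℕ) where
  open Signature Π
  private
    module A = FinStructure A
    module X = FinStructure X

  SubsetX : Set
  SubsetX = (t : Fin nTy) → Subset (X.size t)

  card : SubsetX → ℕ
  card K = sum (List.map (λ t → ∣ K t ∣) (allFin nTy))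

  _⊆X_ : SubsetX → SubsetX → Set
  L ⊆X K = (t : Fin nTy) → L t ⊆ K t

  PMap : SubsetX → Set
  PMap K = (t : Fin nTy) (x : Fin (X.size t)) → x ∈ K t → Fin (A.size t)

  InK : SubsetX → {ts : List (Fin nTy)} → All (λ t → Fin (X.size t)) ts → Set
  InK K [] = ⊤
  InK K (_∷_ {x = t} v vs) = (v ∈ K t) × InK K vs

  apply : {K : SubsetX} {ts : List (Fin nTy)} → PMap K →
          (xs : All (λ t → Fin (X.size t)) ts) → InK K xs → All (λ t → Fin (A.size t)) ts
  apply f [] _ = []
  apply f (_∷_ {x = t} v vs) (p , ps) = f t v p ∷ apply f vs ps

  IsPHom : {K : SubsetX} → PMap K → Set
  IsPHom {K} f = (R : Fin nSym) (xs : All (λ t → Fin (X.size t)) (ar R)) (ps : InK K xs) →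
                 X.Rel R xs → A.Rel R (apply f xs ps)

  restrict : {L K : SubsetX} → L ⊆X K → PMap K → PMap L
  restrict L⊆K f t x p = f t x (L⊆K t p)

  -- Removed K f : the map f is (eventually) removed from 𝓕_K by step (2)
  -- repeated until stabilisation (least fixed point of the removal rules).
  data Removed : (K : SubsetX) → PMap K → Set where
    unextendable : {L : SubsetX} (f : PMap L) (K : SubsetX) → card K ≤ k → (L⊆K : L ⊆X K) →
                   ((g : PMap K) → IsPHom g →
                     ((t : Fin nTy) (x : Fin (X.size t)) (p : x ∈ L t) → g t x (L⊆K t p) ≡ f t x p) →
                     Removed K g) →
                   Removed L f
    badRestriction : {K : SubsetX} (g : PMap K) (L : SubsetX) (L⊆K : L ⊆X K) →
                     Removed L (restrict L⊆K g) → Removed K g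

  𝓕 : SubsetX → Set
  𝓕 K = Σ (PMap K) (λ f → IsPHom f × ¬ Removed K f)

  Accepts : Set
  Accepts = (K : SubsetX) → card K ≤ k → 𝓕 K

  liftIn : {L K : SubsetX} → L ⊆X K → {ts : List (Fin nTy)} →
           (xs : All (λ t → Fin (X.size t)) ts) → InK L xs → InK K xs
  liftIn L⊆K [] _ = tt
  liftIn L⊆K (_∷_ {x = t} v vs) (p , ps) = L⊆K t p , liftIn L⊆K vs ps

  apply-restrict : {L K : SubsetX} (L⊆K : L ⊆X K) (f : PMap K) {ts : List (Fin nTy)} →
                   (xs : All (λ t → Fin (X.size t)) ts) (ps : InK L xs) →
                   apply (restrict L⊆K f) xs ps ≡ apply f xs (liftIn L⊆K xs ps)
  apply-restrict L⊆K f [] _ = refl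
  apply-restrict L⊆K f (_∷_ {x = t} v vs) (p , ps) =
    cong (f t v (L⊆K t p) ∷_) (apply-restrict L⊆K f vs ps)

  ρ : {L K : SubsetX} → L ⊆X K → 𝓕 K → 𝓕 L
  ρ {L} L⊆K (f , φ , nr) =
    restrict L⊆K f ,
    (λ R xs ps r → subst (A.Rel R) (sym (apply-restrict L⊆K f xs ps)) (φ R xs (liftIn L⊆K xs ps) r)) ,
    (λ rem → nr (badRestriction f L L⊆K rem))

  Small : Set
  Small = Σ SubsetX (λ K → card K ≤ k)

HasWidth : {Π : Signature} → ℕ → FinStructure Π → Structure Π → Set₁
HasWidth {Π} k A A' =
  (X : FinStructure Π) →
    (Hom (FinStructure.str X) (FinStructure.str A) → Consistency.Accepts A X k) ×
    (Consistency.Accepts A X k → Hom (FinStructure.str X) A')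

module KappaDef {Π Δ : Signature} (k : ℕ) (A : FinStructure Π) (B : Structure Δ)
                (X : FinStructure Π) where
  open Consistency A X k
  open Signature Δ renaming (nTy to nTyΔ; nSym to nSymΔ; ar to arΔ)

  -- disjoint union of the copies B^{𝓕_K}
  BaseDom : Fin nTyΔ → Set
  BaseDom t = Σ Small (λ K → 𝓕 (proj₁ K) → Structure.Dom B t)

  BaseRel : (R : Fin nSymΔ) → All BaseDom (arΔ R) → Set
  BaseRel R xs =
    Σ Small (λ K →
      Σ (All (λ t → 𝓕 (proj₁ K) → Structure.Dom B t) (arΔ R)) (λ bs →
        (xs ≡ All.map (λ b → (K , b)) bs) ×
        Structure.Rel (Pow B (𝓕 (proj₁ K))) R bs))

  base : Structure Δ
  base = record { Dom = BaseDom ; Rel = BaseRel }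

  data Ident (t : Fin nTyΔ) : BaseDom t → BaseDom t → Set where
    ident : (K L : Small) (L⊆K : proj₁ L ⊆X proj₁ K) (b : 𝓕 (proj₁ L) → Structure.Dom B t) →
            Ident t (K , (λ f → b (ρ L⊆K f))) (L , b)

  result : QStructure Δ
  result = record { base = base ; ident = Ident }

κ : {Π Δ : Signature} → ℕ → FinStructure Π → Structure Δ → FinStructure Π → QStructure Δ
κ k A B X = KappaDef.result k A B X

-- A homomorphism κ(X) → ⊥ only has to preserve the nullary symbol C, and C holds in κ(X)
-- exactly when some 𝓕_K with |K| ≤ k is empty. So κ_k^{A,⊥} is a reduction to CSP(⊥)
-- precisely when X → A forces acceptance and acceptance forces X → A′, which is what width k
-- says; the first implication holds for every X anyway, since restrictions of a homomorphism
-- X → A are never removed. Constructively, "no 𝓕_K is empty" gives "every 𝓕_K is inhabited"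
-- only because 𝓕_K is decidable: partial maps are coded as functions into Maybe, and pruning
-- the finite list of partial homomorphisms until no member violates the extension or the
-- restriction rule computes the stable family of step (3).

module Submission where

open import Defs
open import Data.Bool using (Bool; true; false; T; T?)
import Data.Bool as Bool
open import Data.Empty using (⊥-elim)
open import Data.Fin using (Fin; zero; suc)
import Data.Fin.Properties as Fin
open import Data.Fin.Subset using (_∈_; ∣_∣)
open import Data.Fin.Subset.Properties using (_∈?_; _⊆?_)
open import Data.List using (List; []; _∷_; [_]; map; length; allFin; cartesianProduct; filter)
open import Data.List.Properties using (length-removeAt′; map-cong)
open import Data.List.Membership.Propositional using (find) renaming (_∈_ to _∈ₗ_)
open import Data.List.Membership.Propositional.Properties using (∈-allFin)
open import Data.List.Relation.Unary.All using (All; []; _∷_; lookupAny)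
import Data.List.Relation.Unary.All as All
open import Data.List.Relation.Unary.All.Properties using (¬Any⇒All¬; All¬⇒¬Any; ─⁺; ─⁻; all-filter)
open import Data.List.Relation.Unary.Any using (Any; here; there; any?; _─_)
import Data.List.Relation.Unary.Any as Any
open import Data.List.Relation.Unary.Any.Properties
  using (map⁺; cartesianProduct⁺; filter⁺; lookup-result)
open import Data.Maybe using (Maybe; just; nothing; is-just; to-witness-T)
open import Data.Maybe.Properties using (just-injective)
import Data.Maybe.Properties as Maybe
open import Data.Nat using (ℕ; suc; _≤_; _<_; _≤?_; s≤s)
open import Data.Nat.ListAction using (sum)
open import Data.Nat.Properties using (≤-refl; ≤-reflexive; <-≤-trans)
open import Data.Product using (Σ; ∃; _×_; _,_; proj₁; proj₂; uncurry)
open import Data.Sum using (_⊎_; inj₁; inj₂)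
open import Data.Unit using (tt)
open import Data.Vec using (tabulate; lookup)
import Data.Vec.Properties as Vec
open import Data.Vec.Properties
  using (lookup∘tabulate; tabulate∘lookup; tabulate-cong; []=⇒lookup; lookup⇒[]=)
open import Data.Vec.Properties.WithK using ([]=-irrelevant)
open import Function using (_∘_; _$_; Equivalence)
open import Function.Bundles using (_⇔_; mk⇔)
open import Data.Bool.Properties using (T-≡)
open import Relation.Binary.PropositionalEquality using (_≡_; refl; sym; trans; cong; cong₂; subst)
open import Relation.Nullary using (Dec; yes; no; ¬_)
open import Relation.Nullary.Decidable using (map′; _×-dec_; _⊎-dec_; _→-dec_; ¬?; decidable-stable)

allFunctions : ∀ {n} {B : Fin n → Set} → ((i : Fin n) → List (B i)) → List ((i : Fin n) → B i)
allFunctions {0} _ = [ (λ ()) ]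
allFunctions {suc n} ls =
  map (uncurry Fin.∀-cons) (cartesianProduct (ls zero) (allFunctions (ls ∘ suc)))

allFunctions-complete : ∀ {n} {B : Fin n → Set} (ls : (i : Fin n) → List (B i))
  (R : (i : Fin n) → B i → B i → Set) {h : (i : Fin n) → B i} →
  (∀ i → Any (λ b → R i b (h i)) (ls i)) →
  Any (λ h′ → ∀ i → R i (h′ i) (h i)) (allFunctions ls)
allFunctions-complete {0} _ _ _ = here (λ ())
allFunctions-complete {suc n} ls R hit =
  map⁺ (Any.map (uncurry Fin.∀-cons)
    (cartesianProduct⁺ (hit zero) (allFunctions-complete (ls ∘ suc) (R ∘ suc) (hit ∘ suc))))

∀-All? : {I : Set} {n : I → ℕ} {is : List I} {P : All (λ i → Fin (n i)) is → Set} →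
         (∀ xs → Dec (P xs)) → Dec (∀ xs → P xs)
∀-All? {is = []} P? = map′ (λ p → λ { [] → p }) (_$ []) (P? [])
∀-All? {is = i ∷ is} P? =
  map′ (λ p → λ { (x ∷ xs) → p x xs }) (λ p x xs → p (x ∷ xs))
       (Fin.all? λ x → ∀-All? (λ xs → P? (x ∷ xs)))

module Pruning {U : Set} (Bad : List U → U → Set) (Bad? : ∀ S x → Dec (Bad S x)) where

  Stable : List U → Set
  Stable S = All (λ x → ¬ Bad S x) S

  ─-shrinks : ∀ {P : U → Set} {S} (p : Any P S) → length (S ─ p) < length S
  ─-shrinks {S = S} p = ≤-reflexive (sym (length-removeAt′ S (Any.index p)))

  prune : (Inv : List U → Set) → (∀ {S} (b : Any (Bad S) S) → Inv S → Inv (S ─ b)) →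
          (S : List U) → Inv S → Σ (List U) (λ S′ → Inv S′ × Stable S′)
  prune Inv Inv-─ S = go (suc (length S)) S ≤-refl
    where
    go : (n : ℕ) (S : List U) → length S < n → Inv S → Σ (List U) (λ S′ → Inv S′ × Stable S′)
    go (suc n) S (s≤s |S|≤n) inv with any? (Bad? S) S
    ... | no ¬bad = S , inv , ¬Any⇒All¬ S ¬bad
    ... | yes b   = go n (S ─ b) (<-≤-trans (─-shrinks b) |S|≤n) (Inv-─ b inv)

module PartialMaps {Π : Signature} (A X : FinStructure Π) (k : ℕ) where
  open Signature Π
  open Consistency A X k
  private
    module A = FinStructure A
    module X = FinStructure X

  infix 4 _≐_ _≅_

  _≐_ : SubsetX → SubsetX → Set
  L ≐ K = ∀ t → L t ≡ K t

  ≐-sym : {L K : SubsetX} → L ≐ K → K ≐ L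
  ≐-sym L≐K t = sym (L≐K t)

  ≐⇒⊆ : {L K : SubsetX} → L ≐ K → L ⊆X K
  ≐⇒⊆ L≐K t {x} = subst (x ∈_) (L≐K t)

  ⊆X-trans : {L K M : SubsetX} → L ⊆X K → K ⊆X M → L ⊆X M
  ⊆X-trans L⊆K K⊆M t p = K⊆M t (L⊆K t p)

  card-≐ : {L K : SubsetX} → L ≐ K → card L ≡ card K
  card-≐ L≐K = cong sum (map-cong (λ t → cong ∣_∣ (L≐K t)) (allFin nTy))

  -- Removed is indexed by the exact domain and a PMap consumes membership proofs, so partial
  -- maps can only be compared up to this relation.
  record _≅_ {L K : SubsetX} (f : PMap L) (g : PMap K) : Set where
    field
      same-dom : L ≐ K
      same-val : ∀ t x (p : x ∈ L t) (q : x ∈ K t) → f t x p ≡ g t x q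
  open _≅_

  ≅-refl : {L : SubsetX} (f : PMap L) → f ≅ f
  ≅-refl f = record
    { same-dom = λ _ → refl ; same-val = λ t x p q → cong (f t x) ([]=-irrelevant p q) }

  ≅-sym : {L K : SubsetX} {f : PMap L} {g : PMap K} → f ≅ g → g ≅ f
  ≅-sym f≅g = record
    { same-dom = ≐-sym (same-dom f≅g) ; same-val = λ t x p q → sym (same-val f≅g t x q p) }

  ≅-trans : {L K M : SubsetX} {f : PMap L} {g : PMap K} {h : PMap M} → f ≅ g → g ≅ h → f ≅ h
  ≅-trans f≅g g≅h = record
    { same-dom = λ t → trans (same-dom f≅g t) (same-dom g≅h t)
    ; same-val = λ t x p r →
        trans (same-val f≅g t x p (≐⇒⊆ (same-dom f≅g) t p)) (same-val g≅h t x _ r) }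

  restrict-≅ : {L L′ K K′ : SubsetX} (L⊆K : L ⊆X K) (L′⊆K′ : L′ ⊆X K′) {f : PMap K} {g : PMap K′} →
               L ≐ L′ → f ≅ g → restrict L⊆K f ≅ restrict L′⊆K′ g
  restrict-≅ L⊆K L′⊆K′ L≐L′ f≅g = record
    { same-dom = L≐L′ ; same-val = λ t x p q → same-val f≅g t x (L⊆K t p) (L′⊆K′ t q) }

  cast : {L K : SubsetX} → L ≐ K → PMap L → PMap K
  cast L≐K f t x p = f t x (≐⇒⊆ (≐-sym L≐K) t p)

  cast-≅ : {L K : SubsetX} (L≐K : L ≐ K) (f : PMap L) → f ≅ cast L≐K f
  cast-≅ L≐K f = record { same-dom = L≐K ; same-val = λ t x p q → same-val (≅-refl f) t x p _ }

  apply-≅ : {L K : SubsetX} {f : PMap L} {g : PMap K} → f ≅ g → {ts : List (Fin nTy)} →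
            (xs : All (λ t → Fin (X.size t)) ts) (ps : InK L xs) (qs : InK K xs) →
            apply f xs ps ≡ apply g xs qs
  apply-≅ f≅g [] _ _ = refl
  apply-≅ f≅g (_∷_ {x = t} x xs) (p , ps) (q , qs) =
    cong₂ _∷_ (same-val f≅g t x p q) (apply-≅ f≅g xs ps qs)

  IsPHom-resp : {L K : SubsetX} {f : PMap L} {g : PMap K} → f ≅ g → IsPHom f → IsPHom g
  IsPHom-resp f≅g φ R xs qs r =
    subst (A.Rel R) (apply-≅ f≅g xs ps qs) (φ R xs ps r)
    where ps = liftIn (≐⇒⊆ (≐-sym (same-dom f≅g))) xs qs

  restrict-IsPHom : {L K : SubsetX} (L⊆K : L ⊆X K) {f : PMap K} → IsPHom f → IsPHom (restrict L⊆K f)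
  restrict-IsPHom L⊆K {f} φ R xs ps r =
    subst (A.Rel R) (sym (apply-restrict L⊆K f xs ps)) (φ R xs (liftIn L⊆K xs ps) r)

  Removed-resp : {L K : SubsetX} {f : PMap L} {g : PMap K} → f ≅ g → Removed L f → Removed K g
  Removed-resp f≅g (unextendable f M |M|≤k L⊆M unext) =
    unextendable _ M |M|≤k (⊆X-trans (≐⇒⊆ (≐-sym (same-dom f≅g))) L⊆M)
      (λ h φ ext → unext h φ λ t x p →
        trans (cong (h t x) ([]=-irrelevant _ _))
              (trans (ext t x (≐⇒⊆ (same-dom f≅g) t p)) (sym (same-val f≅g t x p _))))
  Removed-resp f≅g (badRestriction f M M⊆L rem) =
    badRestriction _ M (⊆X-trans M⊆L (≐⇒⊆ (same-dom f≅g)))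
      (Removed-resp (restrict-≅ M⊆L _ (λ _ → refl) f≅g) rem)

  module _ (h : Hom (FinStructure.str X) (FinStructure.str A)) where

    restrictHom : (L : SubsetX) → PMap L
    restrictHom L t x _ = Hom.fun h t x

    apply-restrictHom : {L : SubsetX} {ts : List (Fin nTy)} (xs : All (λ t → Fin (X.size t)) ts)
                        (ps : InK L xs) →
                        apply (restrictHom L) xs ps ≡ All.map (λ {t} → Hom.fun h t) xs
    apply-restrictHom [] _ = refl
    apply-restrictHom (x ∷ xs) (_ , ps) = cong (_ ∷_) (apply-restrictHom xs ps)

    restrictHom-IsPHom : (L : SubsetX) → IsPHom (restrictHom L)
    restrictHom-IsPHom L R xs ps r =
      subst (A.Rel R) (sym (apply-restrictHom xs ps)) (Hom.pres h R xs r)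

    restrictHom-not-removed : {L : SubsetX} (f : PMap L) →
                              (∀ t x p → f t x p ≡ Hom.fun h t x) → ¬ Removed L f
    restrictHom-not-removed f f≡h (unextendable f K _ _ unext) =
      restrictHom-not-removed (restrictHom K) (λ _ _ _ → refl)
        (unext (restrictHom K) (restrictHom-IsPHom K) (λ t x p → sym (f≡h t x p)))
    restrictHom-not-removed f f≡h (badRestriction f L L⊆K rem) =
      restrictHom-not-removed _ (λ t x p → f≡h t x (L⊆K t p)) rem

    hom⇒accepts : Accepts
    hom⇒accepts K _ =
      restrictHom K , restrictHom-IsPHom K ,
      restrictHom-not-removed (restrictHom K) (λ _ _ _ → refl)

module Codes {Π : Signature} (A X : FinStructure Π) (k : ℕ) where
  open Signature Π
  open Consistency A X k
  open PartialMaps A X k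
  open _≅_
  private
    module A = FinStructure A
    module X = FinStructure X

  -- A partial map, domain included, as a total function into Maybe: codes can be enumerated
  -- and compared.
  Code : Set
  Code = (t : Fin nTy) → Fin (X.size t) → Maybe (Fin (A.size t))

  dom : Code → SubsetX
  dom c t = tabulate (λ x → is-just (c t x))

  ∈-dom⁻ : (c : Code) {t : Fin nTy} {x : Fin (X.size t)} → x ∈ dom c t → T (is-just (c t x))
  ∈-dom⁻ c {t} {x} p =
    Equivalence.from T-≡ (trans (sym (lookup∘tabulate _ x)) ([]=⇒lookup p))

  ∈-dom⁺ : (c : Code) {t : Fin nTy} {x : Fin (X.size t)} → T (is-just (c t x)) → x ∈ dom c t
  ∈-dom⁺ c {t} {x} j =
    lookup⇒[]= x _ (trans (lookup∘tabulate _ x) (Equivalence.to T-≡ j))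

  decode : (c : Code) → PMap (dom c)
  decode c t x p = to-witness-T (c t x) (∈-dom⁻ c p)

  decode-just : (c : Code) {t : Fin nTy} {x : Fin (X.size t)} (p : x ∈ dom c t) →
                c t x ≡ just (decode c t x p)
  decode-just c {t} {x} p = to-witness-T-just (c t x) (∈-dom⁻ c p)
    where
    to-witness-T-just : {B : Set} (m : Maybe B) (j : T (is-just m)) → m ≡ just (to-witness-T m j)
    to-witness-T-just (just _) _ = refl

  encode : {K : SubsetX} → PMap K → Code
  encode {K} f t x with x ∈? K t
  ... | yes p = just (f t x p)
  ... | no _  = nothing

  encode-just : {K : SubsetX} (f : PMap K) {t : Fin nTy} {x : Fin (X.size t)} (p : x ∈ K t) →
                encode f t x ≡ just (f t x p)
  encode-just {K} f {t} {x} p with x ∈? K t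
  ... | yes q = cong just (cong (f t x) ([]=-irrelevant q p))
  ... | no ¬p = ⊥-elim (¬p p)

  dom-encode : {K : SubsetX} (f : PMap K) → dom (encode f) ≐ K
  dom-encode {K} f t = trans (tabulate-cong is-just-encode) (tabulate∘lookup (K t))
    where
    is-just-encode : ∀ x → is-just (encode f t x) ≡ lookup (K t) x
    is-just-encode x with x ∈? K t
    ... | yes p = sym ([]=⇒lookup p)
    ... | no ¬p with lookup (K t) x in eq
    ...   | true  = ⊥-elim (¬p (lookup⇒[]= x _ eq))
    ...   | false = refl

  decode-encode : {K : SubsetX} (f : PMap K) → decode (encode f) ≅ f
  decode-encode f = record
    { same-dom = dom-encode f
    ; same-val = λ t x p q →
        just-injective (trans (sym (decode-just (encode f) p)) (encode-just f q)) }

  infix 4 _≈_ _≈?_ _∈≈_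

  _≈_ : Code → Code → Set
  c ≈ d = ∀ t x → c t x ≡ d t x

  _≈?_ : (c d : Code) → Dec (c ≈ d)
  c ≈? d = Fin.all? λ t → Fin.all? λ x → Maybe.≡-dec Fin._≟_ (c t x) (d t x)

  ≈⇒≅ : {c d : Code} → c ≈ d → decode c ≅ decode d
  ≈⇒≅ {c} {d} c≈d = record
    { same-dom = λ t → tabulate-cong (λ x → cong is-just (c≈d t x))
    ; same-val = λ t x p q →
        just-injective (trans (sym (decode-just c p)) (trans (c≈d t x) (decode-just d q))) }

  ≈-encode : {K : SubsetX} {c : Code} {f : PMap K} → c ≈ encode f →
             dom c ≐ K × (∀ t x (p : x ∈ K t) → c t x ≡ just (f t x p))
  ≈-encode {f = f} c≈ =
    same-dom (≅-trans (≈⇒≅ c≈) (decode-encode f)) , λ t x p → trans (c≈ t x) (encode-just f p)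

  _∈≈_ : Code → List Code → Set
  c ∈≈ S = Any (_≈ c) S

  Extends : Code → Code → Set
  Extends g s = ∀ t x → T (is-just (s t x)) → g t x ≡ s t x

  Extends? : (g s : Code) → Dec (Extends g s)
  Extends? g s = Fin.all? λ t → Fin.all? λ x →
    T? (is-just (s t x)) →-dec Maybe.≡-dec Fin._≟_ (g t x) (s t x)

  decode-Extends : {g s : Code} → Extends g s → ∀ {t x} (p : x ∈ dom s t) (q : x ∈ dom g t) →
                   decode g t x q ≡ decode s t x p
  decode-Extends {g} {s} g⊒s {t} {x} p q =
    just-injective (trans (sym (decode-just g q)) (trans (g⊒s t x (∈-dom⁻ s p)) (decode-just s p)))

  Extends⇒≅restrict : {s r : Code} {L : SubsetX} → Extends s r → dom r ≐ L →
                      (L⊆s : L ⊆X dom s) → decode r ≅ restrict L⊆s (decode s)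
  Extends⇒≅restrict s⊒r dom≐L L⊆s = record
    { same-dom = dom≐L ; same-val = λ t x p q → sym (decode-Extends s⊒r p (L⊆s t q)) }

  PHom : Code → Set
  PHom c = IsPHom (decode c)

  InK? : (K : SubsetX) {ts : List (Fin nTy)} (xs : All (λ t → Fin (X.size t)) ts) → Dec (InK K xs)
  InK? K [] = yes tt
  InK? K (_∷_ {x = t} x xs) = (x ∈? K t) ×-dec InK? K xs

  IsPHom? : {K : SubsetX} (f : PMap K) → Dec (IsPHom f)
  IsPHom? {K} f = Fin.all? λ R → ∀-All? (preserves? R)
    where
    preserves? : (R : Fin nSym) (xs : All (λ t → Fin (X.size t)) (ar R)) →
                 Dec ((ps : InK K xs) → X.Rel R xs → A.Rel R (apply f xs ps))
    preserves? R xs with InK? K xs | X.rel? R xs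
    ... | no ∉K  | _      = yes λ ps → ⊥-elim (∉K ps)
    ... | yes _  | no ¬r  = yes λ _ r → ⊥-elim (¬r r)
    ... | yes ps | yes r  with A.rel? R (apply f xs ps)
    ...   | yes a = yes λ qs _ → subst (A.Rel R) (apply-≅ (≅-refl f) xs ps qs) a
    ...   | no ¬a = no λ pres → ¬a (pres ps r)

  codes : List Code
  codes = allFunctions λ t → allFunctions λ _ → nothing ∷ map just (allFin (A.size t))

  codes-complete : (c : Code) → c ∈≈ codes
  codes-complete c = allFunctions-complete _ (λ _ u v → ∀ x → u x ≡ v x)
    λ t → allFunctions-complete _ (λ _ → _≡_) λ x → value-listed (c t x)
    where
    value-listed : ∀ {n} (m : Maybe (Fin n)) → Any (_≡ m) (nothing ∷ map just (allFin n))
    value-listed nothing  = here refl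
    value-listed (just a) = there (map⁺ (Any.map (cong just ∘ sym) (∈-allFin a)))

  subsets : List SubsetX
  subsets = allFunctions λ t → map tabulate (allFunctions λ _ → true ∷ false ∷ [])

  subsets-complete : (K : SubsetX) → Any (_≐ K) subsets
  subsets-complete K = allFunctions-complete _ (λ _ → _≡_) λ t →
    map⁺ (Any.map (λ L≗K → trans (tabulate-cong L≗K) (tabulate∘lookup (K t)))
      (allFunctions-complete _ (λ _ → _≡_) λ x → bool-listed (lookup (K t) x)))
    where
    bool-listed : (b : Bool) → Any (_≡ b) (true ∷ false ∷ [])
    bool-listed true  = here refl
    bool-listed false = there (here refl)

  _∈≈?_ : (c : Code) (S : List Code) → Dec (c ∈≈ S)
  c ∈≈? S = any? (_≈? c) S

  _≐?_ : (L K : SubsetX) → Dec (L ≐ K)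
  L ≐? K = Fin.all? λ t → Vec.≡-dec Bool._≟_ (L t) (K t)

  _⊆X?_ : (L K : SubsetX) → Dec (L ⊆X K)
  L ⊆X? K = Fin.all? λ t → L t ⊆? K t

  -- The two removal rules of step (2), read on a finite list S of candidates.
  Unextendable : List Code → Code → Set
  Unextendable S s =
    Any (λ K → card K ≤ k × dom s ⊆X K × ¬ Any (λ g → dom g ≐ K × Extends g s) S) subsets

  BadRestriction : List Code → Code → Set
  BadRestriction S s = Any (λ L → L ⊆X dom s × ¬ Any (λ r → dom r ≐ L × Extends s r) S) subsets

  Bad : List Code → Code → Set
  Bad S s = Unextendable S s ⊎ BadRestriction S s

  Bad? : (S : List Code) (s : Code) → Dec (Bad S s)
  Bad? S s =
    any? (λ K → card K ≤? k ×-dec dom s ⊆X? K ×-dec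
                ¬? (any? (λ g → dom g ≐? K ×-dec Extends? g s) S)) subsets
    ⊎-dec
    any? (λ L → L ⊆X? dom s ×-dec ¬? (any? (λ r → dom r ≐? L ×-dec Extends? s r) S)) subsets

  open Pruning Bad Bad?

  record Candidates (S : List Code) : Set where
    field
      phoms  : All PHom S
      covers : ∀ c → PHom c → ¬ c ∈≈ S → Removed (dom c) (decode c)
  open Candidates

  missing⇒removed : {S : List Code} → Candidates S → {K : SubsetX} (f : PMap K) → IsPHom f →
                    ¬ encode f ∈≈ S → Removed K f
  missing⇒removed cand f φ ∉S =
    Removed-resp (decode-encode f)
      (covers cand (encode f) (IsPHom-resp (≅-sym (decode-encode f)) φ) ∉S)

  bad⇒removed : {S : List Code} → Candidates S → {s : Code} → PHom s → Bad S s →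
                Removed (dom s) (decode s)
  bad⇒removed cand {s} _ (inj₁ unext) with find unext
  ... | K , _ , |K|≤k , s⊆K , noExtension =
    unextendable (decode s) K |K|≤k s⊆K λ g φ ext →
      missing⇒removed cand g φ λ g∈S → noExtension (Any.map (extends g ext) g∈S)
    where
    extends : (g : PMap K) → (∀ t x p → g t x (s⊆K t p) ≡ decode s t x p) →
              ∀ {c} → c ≈ encode g → dom c ≐ K × Extends c s
    extends g ext c≈ with ≈-encode c≈
    ... | dom≐K , c≡g = dom≐K , λ t x j →
      let p = ∈-dom⁺ s j in
      trans (c≡g t x (s⊆K t p)) (trans (cong just (ext t x p)) (sym (decode-just s p)))
  bad⇒removed cand {s} φ (inj₂ badRestr) with find badRestr
  ... | L , _ , L⊆s , noRestriction =
    badRestriction (decode s) L L⊆s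
      (missing⇒removed cand (restrict L⊆s (decode s)) (restrict-IsPHom L⊆s φ)
        λ r∈S → noRestriction (Any.map restricts r∈S))
    where
    restricts : ∀ {c} → c ≈ encode (restrict L⊆s (decode s)) → dom c ≐ L × Extends s c
    restricts {c} c≈ with ≈-encode c≈
    ... | dom≐L , c≡s = dom≐L , λ t x j →
      let p = ≐⇒⊆ dom≐L t (∈-dom⁺ c j) in
      trans (decode-just s (L⊆s t p)) (sym (c≡s t x p))

  Candidates-─ : {S : List Code} (b : Any (Bad S) S) → Candidates S → Candidates (S ─ b)
  Candidates-─ {S} b cand = record { phoms = ─⁺ b (phoms cand) ; covers = covers′ }
    where
    covers′ : ∀ c → PHom c → ¬ c ∈≈ (S ─ b) → Removed (dom c) (decode c)
    covers′ c φ c∉ with c ∈≈? S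
    ... | no c∉S = covers cand c φ c∉S
    ... | yes c∈S with Any.lookup b ≈? c
    ...   | no b≉c = ⊥-elim (All¬⇒¬Any (─⁻ b b≉c (¬Any⇒All¬ _ c∉)) c∈S)
    ...   | yes b≈c with lookupAny (phoms cand) b
    ...     | φb , bad = Removed-resp (≈⇒≅ b≈c) (bad⇒removed cand φb bad)

  initialCandidates : Candidates (filter (IsPHom? ∘ decode) codes)
  initialCandidates = record { phoms = all-filter (IsPHom? ∘ decode) codes ; covers = covers₀ }
    where
    covers₀ : ∀ c → PHom c → ¬ c ∈≈ filter (IsPHom? ∘ decode) codes → Removed (dom c) (decode c)
    covers₀ c φ c∉ with filter⁺ (IsPHom? ∘ decode) (codes-complete c)
    ... | inj₁ c∈ = ⊥-elim (c∉ c∈)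
    ... | inj₂ ¬φ =
      ⊥-elim (¬φ (IsPHom-resp (≈⇒≅ (λ t x → sym (lookup-result (codes-complete c) t x))) φ))

  module _ {S : List Code} (cand : Candidates S) (stable : Stable S) where

    stable-extension : {s : Code} → s ∈ₗ S → {K : SubsetX} → card K ≤ k → dom s ⊆X K →
                       ∃ λ g → g ∈ₗ S × dom g ≐ K × Extends g s
    stable-extension s∈S {K} |K|≤k s⊆K with find (subsets-complete K)
    ... | K′ , K′∈ , K′≐K with decidable-stable (any? (λ g → dom g ≐? K′ ×-dec Extends? g _) S)
      (λ noExtension → All.lookup stable s∈S
        (inj₁ (Any.map (λ { refl → subst (_≤ k) (sym (card-≐ K′≐K)) |K|≤k
                                   , ⊆X-trans s⊆K (≐⇒⊆ (≐-sym K′≐K)) , noExtension }) K′∈)))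
    ... | ext with find ext
    ...   | g , g∈S , dom≐K′ , g⊒s = g , g∈S , (λ t → trans (dom≐K′ t) (K′≐K t)) , g⊒s

    stable-restriction : {s : Code} → s ∈ₗ S → {L : SubsetX} (L⊆s : L ⊆X dom s) →
                         ∃ λ r → r ∈ₗ S × decode r ≅ restrict L⊆s (decode s)
    stable-restriction s∈S {L} L⊆s with find (subsets-complete L)
    ... | L′ , L′∈ , L′≐L with decidable-stable (any? (λ r → dom r ≐? L′ ×-dec Extends? _ r) S)
      (λ noRestriction → All.lookup stable s∈S
        (inj₂ (Any.map (λ { refl → ⊆X-trans (≐⇒⊆ L′≐L) L⊆s , noRestriction }) L′∈)))
    ... | restr with find restr
    ...   | r , r∈S , dom≐L′ , s⊒r =
      r , r∈S , Extends⇒≅restrict s⊒r (λ t → trans (dom≐L′ t) (L′≐L t)) L⊆s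

    survivor-not-removed : {s : Code} → s ∈ₗ S → {L : SubsetX} {f : PMap L} → decode s ≅ f →
                           ¬ Removed L f
    survivor-not-removed s∈S s≅f (unextendable f K |K|≤k L⊆K unext)
      with stable-extension s∈S |K|≤k (⊆X-trans (≐⇒⊆ (same-dom s≅f)) L⊆K)
    ... | g , g∈S , dom≐K , g⊒s =
      survivor-not-removed g∈S (cast-≅ dom≐K (decode g))
        (unext (cast dom≐K (decode g))
               (IsPHom-resp (cast-≅ dom≐K (decode g)) (All.lookup (phoms cand) g∈S))
               (λ t x p → let p′ = ≐⇒⊆ (≐-sym (same-dom s≅f)) t p in
                  trans (decode-Extends g⊒s p′ (≐⇒⊆ (≐-sym dom≐K) t (L⊆K t p)))
                        (same-val s≅f t x p′ p)))
    survivor-not-removed s∈S s≅f (badRestriction f L L⊆K rem)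
      with stable-restriction s∈S (⊆X-trans L⊆K (≐⇒⊆ (≐-sym (same-dom s≅f))))
    ... | r , r∈S , r≅ =
      survivor-not-removed r∈S
        (≅-trans r≅ (restrict-≅ (⊆X-trans L⊆K (≐⇒⊆ (≐-sym (same-dom s≅f)))) L⊆K (λ _ → refl) s≅f))
        rem

    𝓕? : (K : SubsetX) → Dec (𝓕 K)
    𝓕? K with any? (λ s → dom s ≐? K) S
    ... | yes found with find found
    ...   | s , s∈S , dom≐K =
      yes ( cast dom≐K (decode s)
          , IsPHom-resp (cast-≅ dom≐K (decode s)) (All.lookup (phoms cand) s∈S)
          , survivor-not-removed s∈S (cast-≅ dom≐K (decode s)) )
    𝓕? K | no none = no λ (f , φ , survives) →
      survives (missing⇒removed cand f φ λ f∈S → none (Any.map (proj₁ ∘ ≈-encode) f∈S))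

  decide-𝓕 : (K : SubsetX) → Dec (𝓕 K)
  decide-𝓕 with prune Candidates Candidates-─ _ initialCandidates
  ... | _ , cand , stable = 𝓕? cand stable

module IntoBottom {Π : Signature} (A X : FinStructure Π) (k : ℕ) where
  open Consistency A X k

  accepts⇒κ⊥ : Accepts → QHom (κ k A ⊥S X) ⊥S
  accepts⇒κ⊥ accepts = record
    { hom  = record
      { fun  = λ ()
      ; pres = λ { _ _ ((K , |K|≤k) , _ , _ , 𝓕K-empty) → 𝓕K-empty (accepts K |K|≤k) } }
    ; resp = λ () }

  κ⊥⇒accepts : QHom (κ k A ⊥S X) ⊥S → Accepts
  κ⊥⇒accepts q K |K|≤k = decidable-stable (Codes.decide-𝓕 A X k K) λ 𝓕K-empty →
    Hom.pres (QHom.hom q) zero [] ((K , |K|≤k) , [] , refl , 𝓕K-empty)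

theorem4p1 : {Π : Signature} (A : FinStructure Π) (A' : Structure Π) →
    Hom (FinStructure.str A) A' → (k : ℕ) → 1 ≤ k →
    HasWidth k A A' ⇔ IsReduction (κ k A ⊥S) (FinStructure.str A) A' ⊥S ⊥S
theorem4p1 A A' _ k _ = mk⇔
  (λ width X → accepts⇒κ⊥ X k ∘ proj₁ (width X) , proj₂ (width X) ∘ κ⊥⇒accepts X k)
  (λ reduction X → PartialMaps.hom⇒accepts A X k , proj₂ (reduction X) ∘ accepts⇒κ⊥ X k)
  where open IntoBottom A
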